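{- Over data $\omega$-words, every formula of $\mathsf{Formulas}(\{\mathtt Y^g,\mathtt Y^c\})$ is equivalent to a formula of the $\nu$-fragment. Consequently, over data words and over data $\omega$-words, every formula of $\mathsf{Comp}(\mathsf{Formulas}(\{\mathtt Y^g,\mathtt Y^c\})\cup \nu\text{ -fragment})$ is equivalent to a formula of the $\nu$-fragment, i.e. $\mathsf{Comp}(\mathsf{Formulas}(\{\mathtt Y^g,\mathtt Y^c\})\cup\nu\text{ -fragment})=\nu\text{ -fragment}$ up to equivalence.
   Context: Data words (data $\omega$-words) are finite (infinite) sequences over $\Sigma\times\mathcal D$ ($\Sigma$ finite alphabet, $\mathcal D$ infinite); $i\sim j$ iff positions $i,j$ carry the same data value; the class successor/predecessor of $i$ is the nearest later/earlier position $j\sim i$. $\mu$-calculus: $\varphi::= x\mid A\mid\neg A\mid \mathsf M\varphi\mid\varphi\vee\varphi\mid\varphi\wedge\varphi\mid\mu x.\varphi\mid\nu x.\varphi$, with fixpoint variables $x$, atoms $A$: letters of $\Sigma$ and zeroary $\mathsf S,\mathsf P,\mathsf{first}^g,\mathsf{last}^g,\mathsf{first}^c,\mathsf{last}^c$; unary modalities $\mathsf M\in\{\mathtt X^g,\mathtt X^c,\mathtt Y^g,\mathtt Y^c\}$ evaluating the argument at the successor, class successor, predecessor, class predecessor respectively (false if nonexistent). Letters hold where they label the position; $\mathsf{first}^g$/$\mathsf{last}^g$ at the first/last position (no last position in an $\omega$-word); $\mathsf{first}^c$/$\mathsf{last}^c$ where there is no class predecessor/successor; $\mathsf S$ at $i$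 iff $i$ is not last and $i+1$ is the class successor of $i$; $\mathsf P$ at $i$ iff $i\neq1$ and $i-1$ is the class predecessor of $i$; $\mu,\nu$ least/greatest fixpoints. Equivalence: same denotation on every structure of the class under every valuation of free variables. The $\nu$-fragment: formulas without $\mu$. $\mathsf{Formulas}(M)$: formulas whose unary modalities all lie in $M$. For a set $\Psi$ of formulas: $\mathsf{Comp}^0(\Psi)=\emptyset$; $\mathsf{Comp}^{i+1}(\Psi)=\{\psi(\varphi_1,\dots,\varphi_n)\mid \psi(x_1,\dots,x_n)\in\Psi,\ \varphi_j\in\mathsf{Comp}^i(\Psi)\}$ ($\psi$ with free variables among $x_1,\dots,x_n$, capture-avoiding substitution); $\mathsf{Comp}(\Psi)=\bigcup_i\mathsf{Comp}^i(\Psi)$. -}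

module Defs where

open import Data.Nat using (ℕ; zero; suc; _<_)
open import Data.Fin using (Fin; zero; suc)
open import Data.Maybe using (Maybe; just; nothing)
open import Data.Product using (Σ; _×_; _,_)
open import Data.Sum using (_⊎_)
open import Data.Empty using (⊥)
open import Data.Unit using (⊤)
open import Relation.Nullary using (¬_)
open import Relation.Binary.PropositionalEquality using (_≡_)
open import Function.Bundles using (_⇔_)

-- Syntax (scoped de Bruijn): Fm k n = formulas over the alphabet Fin k
-- whose free fixpoint variables are among the n variables Fin n.

data Atom0 : Set where
  Sa Pa firstg lastg firstc lastc : Atom0

data Mod : Set where
  Xg Xc Yg Yc : Mod

data Fm (k : ℕ) : ℕ → Set where
  var  : ∀ {n} → Fin n → Fm k n
  let' : ∀ {n} → Fin k → Fm k n
  nlet : ∀ {n} → Fin k → Fm k n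
  at0  : ∀ {n} → Atom0 → Fm k n
  nat0 : ∀ {n} → Atom0 → Fm k n
  mod  : ∀ {n} → Mod → Fm k n → Fm k n
  _∨'_ : ∀ {n} → Fm k n → Fm k n → Fm k n
  _∧'_ : ∀ {n} → Fm k n → Fm k n → Fm k n
  μ'   : ∀ {n} → Fm k (suc n) → Fm k n
  ν'   : ∀ {n} → Fm k (suc n) → Fm k n

liftRen : ∀ {n m} → (Fin n → Fin m) → Fin (suc n) → Fin (suc m)
liftRen r zero    = zero
liftRen r (suc j) = suc (r j)

ren : ∀ {k n m} → (Fin n → Fin m) → Fm k n → Fm k m
ren r (var x)    = var (r x)
ren r (let' a)   = let' a
ren r (nlet a)   = nlet a
ren r (at0 a)    = at0 a
ren r (nat0 a)   = nat0 a
ren r (mod M φ)  = mod M (ren r φ)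
ren r (φ ∨' ψ)   = ren r φ ∨' ren r ψ
ren r (φ ∧' ψ)   = ren r φ ∧' ren r ψ
ren r (μ' φ)     = μ' (ren (liftRen r) φ)
ren r (ν' φ)     = ν' (ren (liftRen r) φ)

liftSub : ∀ {k n m} → (Fin n → Fm k m) → Fin (suc n) → Fm k (suc m)
liftSub σ zero    = var zero
liftSub σ (suc j) = ren suc (σ j)

sub : ∀ {k n m} → Fm k n → (Fin n → Fm k m) → Fm k m
sub (var x)   σ = σ x
sub (let' a)  σ = let' a
sub (nlet a)  σ = nlet a
sub (at0 a)   σ = at0 a
sub (nat0 a)  σ = nat0 a
sub (mod M φ) σ = mod M (sub φ σ)
sub (φ ∨' ψ)  σ = sub φ σ ∨' sub ψ σ
sub (φ ∧' ψ)  σ = sub φ σ ∧' sub ψ σ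
sub (μ' φ)    σ = μ' (sub φ (liftSub σ))
sub (ν' φ)    σ = ν' (sub φ (liftSub σ))

ModsIn : ∀ {k n} → (Mod → Set) → Fm k n → Set
ModsIn M (var x)   = ⊤
ModsIn M (let' a)  = ⊤
ModsIn M (nlet a)  = ⊤
ModsIn M (at0 a)   = ⊤
ModsIn M (nat0 a)  = ⊤
ModsIn M (mod N φ) = M N × ModsIn M φ
ModsIn M (φ ∨' ψ)  = ModsIn M φ × ModsIn M ψ
ModsIn M (φ ∧' ψ)  = ModsIn M φ × ModsIn M ψ
ModsIn M (μ' φ)    = ModsIn M φ
ModsIn M (ν' φ)    = ModsIn M φ

PastMods : Mod → Set
PastMods Xg = ⊥
PastMods Xc = ⊥
PastMods Yg = ⊤
PastMods Yc = ⊤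

PastFm : ∀ {k n} → Fm k n → Set
PastFm = ModsIn PastMods

NuFrag : ∀ {k n} → Fm k n → Set
NuFrag (var x)   = ⊤
NuFrag (let' a)  = ⊤
NuFrag (nlet a)  = ⊤
NuFrag (at0 a)   = ⊤
NuFrag (nat0 a)  = ⊤
NuFrag (mod N φ) = NuFrag φ
NuFrag (φ ∨' ψ)  = NuFrag φ × NuFrag ψ
NuFrag (φ ∧' ψ)  = NuFrag φ × NuFrag ψ
NuFrag (μ' φ)    = ⊥
NuFrag (ν' φ)    = NuFrag φ

FmSet : ℕ → Set₁
FmSet k = ∀ {n} → Fm k n → Set

-- Comp^i(Ψ): elements are formulas with no free variables left
-- (ψ(x_1..x_n) with all free variables among x_1..x_n, substituted).
CompN : ∀ {k} → FmSet k → ℕ → Fm k 0 → Set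
CompN Ψ zero    φ = ⊥
CompN {k} Ψ (suc i) φ =
  Σ ℕ λ n → Σ (Fm k n) λ ψ → Σ (Fin n → Fm k 0) λ σ →
    Ψ ψ × (∀ j → CompN Ψ i (σ j)) × (sub ψ σ ≡ φ)

Comp : ∀ {k} → FmSet k → Fm k 0 → Set
Comp Ψ φ = Σ ℕ λ i → CompN Ψ i φ

PastOrNu : ∀ {k} → FmSet k
PastOrNu φ = PastFm φ ⊎ NuFrag φ

-- Structures: data words (len = just n, positions 0..n-1) and
-- data ω-words (len = nothing, positions all of ℕ).

record Word (k : ℕ) (D : Set) : Set where
  field
    len : Maybe ℕ
    lab : ℕ → Fin k
    dat : ℕ → D

InDom : ∀ {k D} → Word k D → ℕ → Set
InDom w i with Word.len w
... | just n  = i < n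
... | nothing = ⊤

IsFiniteWord : ∀ {k D} → Word k D → Set
IsFiniteWord w = Σ ℕ λ n → Word.len w ≡ just n

IsOmegaWord : ∀ {k D} → Word k D → Set
IsOmegaWord w = Word.len w ≡ nothing

data Ord : Set where
  oz   : Ord
  os   : Ord → Ord
  olim : (ℕ → Ord) → Ord

Pred : Set₁
Pred = ℕ → Set

Val : ℕ → Set₁
Val n = Fin n → Pred

_▹_ : ∀ {n} → Val n → Pred → Val (suc n)
(ρ ▹ P) zero    = P
(ρ ▹ P) (suc j) = ρ j

module Sem {k : ℕ} {D : Set} (w : Word k D) where
  open Word w

  ClassSucc : ℕ → ℕ → Set
  ClassSucc i j = i < j × InDom w j × dat j ≡ dat i ×
                  (∀ m → i < m → m < j → ¬ (dat m ≡ dat i))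

  atom : Atom0 → ℕ → Set
  atom Sa     i = InDom w (suc i) × dat (suc i) ≡ dat i
  atom Pa     i = Σ ℕ λ j → i ≡ suc j × dat j ≡ dat i
  atom firstg i = i ≡ 0
  atom lastg  i = ¬ InDom w (suc i)
  atom firstc i = ¬ (Σ ℕ λ j → j < i × dat j ≡ dat i)
  atom lastc  i = ¬ (Σ ℕ λ j → i < j × InDom w j × dat j ≡ dat i)

  modal : Mod → Pred → Pred
  modal Xg F i = InDom w (suc i) × F (suc i)
  modal Xc F i = Σ ℕ λ j → ClassSucc i j × F j
  modal Yg F i = Σ ℕ λ j → i ≡ suc j × F j
  modal Yc F i = Σ ℕ λ j → ClassSucc j i × F j

  mutual
    ⟦_⟧ : ∀ {n} → Fm k n → Val n → Pred
    ⟦ var x ⟧   ρ i = ρ x i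
    ⟦ let' a ⟧  ρ i = lab i ≡ a
    ⟦ nlet a ⟧  ρ i = ¬ (lab i ≡ a)
    ⟦ at0 a ⟧   ρ i = atom a i
    ⟦ nat0 a ⟧  ρ i = ¬ atom a i
    ⟦ mod M φ ⟧ ρ i = modal M (⟦ φ ⟧ ρ) i
    ⟦ φ ∨' ψ ⟧  ρ i = ⟦ φ ⟧ ρ i ⊎ ⟦ ψ ⟧ ρ i
    ⟦ φ ∧' ψ ⟧  ρ i = ⟦ φ ⟧ ρ i × ⟦ ψ ⟧ ρ i
    ⟦ μ' φ ⟧    ρ i = Σ Ord λ α → muApp φ ρ α i
    ⟦ ν' φ ⟧    ρ i = (α : Ord) → nuApp φ ρ α i

    muApp : ∀ {n} → Fm k (suc n) → Val n → Ord → Pred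
    muApp φ ρ oz       i = ⊥
    muApp φ ρ (os α)   i = ⟦ φ ⟧ (ρ ▹ muApp φ ρ α) i
    muApp φ ρ (olim f) i = Σ ℕ λ m → muApp φ ρ (f m) i

    nuApp : ∀ {n} → Fm k (suc n) → Val n → Ord → Pred
    nuApp φ ρ oz       i = ⊤
    nuApp φ ρ (os α)   i = ⟦ φ ⟧ (ρ ▹ nuApp φ ρ α) i
    nuApp φ ρ (olim f) i = (m : ℕ) → nuApp φ ρ (f m) i

Equiv : ∀ {k n} {D : Set} → (Word k D → Set) → Fm k n → Fm k n → Set₁
Equiv {D = D} C φ ψ =
  ∀ (w : Word _ D) → C w → ∀ ρ i → InDom w i →
    (Sem.⟦_⟧ w φ ρ i ⇔ Sem.⟦_⟧ w ψ ρ i)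

Infinite : Set → Set
Infinite D = Σ (ℕ → D) λ f → ∀ m n → f m ≡ f n → m ≡ n

{-# OPTIONS --safe #-}

-- Past modalities look only at earlier positions. Hence if the variable of a fixpoint occurs
-- only under modalities, the fixpoint is computed by well-founded recursion on positions: its
-- m-th approximants are exact below m, so its least and greatest fixpoints coincide. Any past
-- fixpoint is put into this guarded form without changing its meaning by replacing the
-- occurrences of its variable read at the current position (those not under a modality,
-- after unfolding inner ν's once) by false for μ and by true for ν. Translating inside out
-- turns every past formula into a guarded ν-formula, on arbitrary words. Having a ν-formula
-- equivalent is preserved by substitution, which gives the statement for compositions.

module Submission where

open import Defs
open import Data.Bool using (Bool; true; false)
open import Data.Empty using (⊥; ⊥-elim)
open import Data.Fin using (Fin; zero; suc)
open import Data.Nat using (ℕ; zero; suc; _<_; _≤_; _≟_)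
open import Data.Nat.Properties
  using (≤-refl; ≤-trans; <⇒≤; ≤-<-trans; <-≤-trans; n<1+n; m<n⇒m<1+n; ≤-pred)
open import Data.Product using (Σ; _×_; _,_; proj₁; proj₂)
import Data.Product as Product
open import Data.Sum using (_⊎_; inj₁; inj₂; [_,_])
import Data.Sum as Sum
open import Data.Unit using (⊤; tt)
open import Data.Vec.Functional using (_∷_)
open import Function using (id; const; _∘_)
open import Function.Bundles using (mk⇔)
open import Relation.Binary.PropositionalEquality using (_≡_; refl; sym; trans)
open import Relation.Nullary.Decidable using (toSum)
open import Relation.Nullary.Negation using (contradiction)
open import Relation.Unary using (_⊆_; _≐_; _∪_; _∩_; ⋃; ⋂)
open import Relation.Unary.Properties using (≐-refl; ≐-sym; ≐-trans)

private variable
  k n m : ℕ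

-- g v ≡ true: the variable v may occur only under a modality.
Guarded : (Fin n → Bool) → Fm k n → Set
Guarded g (var v)   = g v ≡ false
Guarded g (let' a)  = ⊤
Guarded g (nlet a)  = ⊤
Guarded g (at0 a)   = ⊤
Guarded g (nat0 a)  = ⊤
Guarded g (mod M φ) = PastMods M × Guarded (const false) φ
Guarded g (φ ∨' ψ)  = Guarded g φ × Guarded g ψ
Guarded g (φ ∧' ψ)  = Guarded g φ × Guarded g ψ
Guarded g (μ' φ)    = ⊥
Guarded g (ν' φ)    = Guarded (true ∷ g) φ

Guarded⇒NuFrag : {g : Fin n → Bool} (φ : Fm k n) → Guarded g φ → NuFrag φ
Guarded⇒NuFrag (var v)   p       = tt
Guarded⇒NuFrag (let' a)  p       = tt
Guarded⇒NuFrag (nlet a)  p       = tt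
Guarded⇒NuFrag (at0 a)   p       = tt
Guarded⇒NuFrag (nat0 a)  p       = tt
Guarded⇒NuFrag (mod M φ) (_ , p) = Guarded⇒NuFrag φ p
Guarded⇒NuFrag (φ ∨' ψ)  (p , q) = Guarded⇒NuFrag φ p , Guarded⇒NuFrag ψ q
Guarded⇒NuFrag (φ ∧' ψ)  (p , q) = Guarded⇒NuFrag φ p , Guarded⇒NuFrag ψ q
Guarded⇒NuFrag (ν' φ)    p       = Guarded⇒NuFrag φ p

Guarded-ren : {g : Fin n → Bool} {g′ : Fin m → Bool} (φ : Fm k n) {r : Fin n → Fin m} →
              (∀ v → g v ≡ false → g′ (r v) ≡ false) → Guarded g φ → Guarded g′ (ren r φ)
Guarded-ren (var v)   h p        = h v p
Guarded-ren (let' a)  h p        = tt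
Guarded-ren (nlet a)  h p        = tt
Guarded-ren (at0 a)   h p        = tt
Guarded-ren (nat0 a)  h p        = tt
Guarded-ren (mod M φ) h (pM , p) = pM , Guarded-ren φ (λ _ _ → refl) p
Guarded-ren (φ ∨' ψ)  h (p , q)  = Guarded-ren φ h p , Guarded-ren ψ h q
Guarded-ren (φ ∧' ψ)  h (p , q)  = Guarded-ren φ h p , Guarded-ren ψ h q
Guarded-ren (ν' φ)    h p        = Guarded-ren φ (λ { zero e → e ; (suc v) → h v }) p

Guarded-sub : {h : Fin n → Bool} {g : Fin m → Bool} (φ : Fm k n) {σ : Fin n → Fm k m} →
              Guarded h φ → (∀ v → h v ≡ false → Guarded g (σ v)) →
              (∀ v → Guarded (const false) (σ v)) → Guarded g (sub φ σ)
Guarded-sub (var v)   p        σ-ok σ-ok₀ = σ-ok v p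
Guarded-sub (let' a)  p        σ-ok σ-ok₀ = tt
Guarded-sub (nlet a)  p        σ-ok σ-ok₀ = tt
Guarded-sub (at0 a)   p        σ-ok σ-ok₀ = tt
Guarded-sub (nat0 a)  p        σ-ok σ-ok₀ = tt
Guarded-sub (mod M φ) (pM , p) σ-ok σ-ok₀ = pM , Guarded-sub φ p (λ v _ → σ-ok₀ v) σ-ok₀
Guarded-sub (φ ∨' ψ)  (p , q)  σ-ok σ-ok₀ = Guarded-sub φ p σ-ok σ-ok₀ , Guarded-sub ψ q σ-ok σ-ok₀
Guarded-sub (φ ∧' ψ)  (p , q)  σ-ok σ-ok₀ = Guarded-sub φ p σ-ok σ-ok₀ , Guarded-sub ψ q σ-ok σ-ok₀
Guarded-sub (ν' φ) {σ} p σ-ok σ-ok₀ =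
  Guarded-sub φ p
    (λ { zero e → e ; (suc v) e → Guarded-ren (σ v) (λ _ e′ → e′) (σ-ok v e) })
    (λ { zero → refl ; (suc v) → Guarded-ren (σ v) (λ _ _ → refl) (σ-ok₀ v) })

NuFrag-ren : (φ : Fm k n) {r : Fin n → Fin m} → NuFrag φ → NuFrag (ren r φ)
NuFrag-ren (var v)   p       = tt
NuFrag-ren (let' a)  p       = tt
NuFrag-ren (nlet a)  p       = tt
NuFrag-ren (at0 a)   p       = tt
NuFrag-ren (nat0 a)  p       = tt
NuFrag-ren (mod M φ) p       = NuFrag-ren φ p
NuFrag-ren (φ ∨' ψ)  (p , q) = NuFrag-ren φ p , NuFrag-ren ψ q
NuFrag-ren (φ ∧' ψ)  (p , q) = NuFrag-ren φ p , NuFrag-ren ψ q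
NuFrag-ren (ν' φ)    p       = NuFrag-ren φ p

NuFrag-sub : (φ : Fm k n) {σ : Fin n → Fm k m} → NuFrag φ → (∀ v → NuFrag (σ v)) →
             NuFrag (sub φ σ)
NuFrag-sub (var v)   p       σ-ok = σ-ok v
NuFrag-sub (let' a)  p       σ-ok = tt
NuFrag-sub (nlet a)  p       σ-ok = tt
NuFrag-sub (at0 a)   p       σ-ok = tt
NuFrag-sub (nat0 a)  p       σ-ok = tt
NuFrag-sub (mod M φ) p       σ-ok = NuFrag-sub φ p σ-ok
NuFrag-sub (φ ∨' ψ)  (p , q) σ-ok = NuFrag-sub φ p σ-ok , NuFrag-sub ψ q σ-ok
NuFrag-sub (φ ∧' ψ)  (p , q) σ-ok = NuFrag-sub φ p σ-ok , NuFrag-sub ψ q σ-ok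
NuFrag-sub (ν' φ) {σ} p      σ-ok =
  NuFrag-sub φ p (λ { zero → tt ; (suc v) → NuFrag-ren (σ v) (σ-ok v) })

-- Since i ≡ 0 is decidable, ⊤F holds everywhere constructively.
⊥F ⊤F : Fm k n
⊥F = at0 firstg ∧' nat0 firstg
⊤F = at0 firstg ∨' nat0 firstg

-- splitSub φ σ τ unfolds once every ν of φ that is not under a modality, then substitutes
-- σ for the variable occurrences not under a modality and τ for the others. For guarded φ
-- the former are exactly the occurrences evaluated at the current position. The μ clause
-- and the ⊥F put for the bound variable of an unfolded ν are junk: guarded formulas have
-- no μ, and their ν-bound variables occur only under modalities.
splitSub : Fm k n → (Fin n → Fm k m) → (Fin n → Fm k m) → Fm k m
splitSub (var v)   σ τ = σ v
splitSub (let' a)  σ τ = let' a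
splitSub (nlet a)  σ τ = nlet a
splitSub (at0 a)   σ τ = at0 a
splitSub (nat0 a)  σ τ = nat0 a
splitSub (mod M φ) σ τ = mod M (sub φ τ)
splitSub (φ ∨' ψ)  σ τ = splitSub φ σ τ ∨' splitSub ψ σ τ
splitSub (φ ∧' ψ)  σ τ = splitSub φ σ τ ∧' splitSub ψ σ τ
splitSub (μ' φ)    σ τ = sub (μ' φ) τ
splitSub (ν' φ)    σ τ = splitSub φ (⊥F ∷ σ) (sub (ν' φ) τ ∷ τ)

Guarded-splitSub : {h : Fin n → Bool} {g : Fin m → Bool} (ψ : Fm k n) {σ τ : Fin n → Fm k m} →
                   Guarded h ψ → (∀ v → h v ≡ false → Guarded g (σ v)) →
                   (∀ v → Guarded (const false) (τ v)) → Guarded g (splitSub ψ σ τ)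
Guarded-splitSub (var v)   p        σ-ok τ-ok = σ-ok v p
Guarded-splitSub (let' a)  p        σ-ok τ-ok = tt
Guarded-splitSub (nlet a)  p        σ-ok τ-ok = tt
Guarded-splitSub (at0 a)   p        σ-ok τ-ok = tt
Guarded-splitSub (nat0 a)  p        σ-ok τ-ok = tt
Guarded-splitSub (mod M φ) (pM , p) σ-ok τ-ok = pM , Guarded-sub φ p (λ v _ → τ-ok v) τ-ok
Guarded-splitSub (φ ∨' ψ)  (p , q)  σ-ok τ-ok =
  Guarded-splitSub φ p σ-ok τ-ok , Guarded-splitSub ψ q σ-ok τ-ok
Guarded-splitSub (φ ∧' ψ)  (p , q)  σ-ok τ-ok =
  Guarded-splitSub φ p σ-ok τ-ok , Guarded-splitSub ψ q σ-ok τ-ok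
Guarded-splitSub (ν' θ)    p        σ-ok τ-ok =
  Guarded-splitSub θ p
    (λ { zero () ; (suc v) → σ-ok v })
    (λ { zero → Guarded-sub (ν' θ) p (λ v _ → τ-ok v) τ-ok ; (suc v) → τ-ok v })

replaceUnguarded₀ : Fm k (suc n) → Fm k (suc n) → Fm k (suc n)
replaceUnguarded₀ χ ψ = splitSub ψ (χ ∷ var ∘ suc) var

replaceUnguarded₀-guarded : (ψ : Fm k (suc n)) {χ : Fm k (suc n)} →
                            Guarded (const false) ψ → Guarded (true ∷ const false) χ →
                            Guarded (true ∷ const false) (replaceUnguarded₀ χ ψ)
replaceUnguarded₀-guarded ψ p χ-ok =
  Guarded-splitSub ψ p (λ { zero _ → χ-ok ; (suc v) _ → refl }) (λ _ → refl)

toNu : Fm k n → Fm k n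
toNu (var v)   = var v
toNu (let' a)  = let' a
toNu (nlet a)  = nlet a
toNu (at0 a)   = at0 a
toNu (nat0 a)  = nat0 a
toNu (mod M φ) = mod M (toNu φ)
toNu (φ ∨' ψ)  = toNu φ ∨' toNu ψ
toNu (φ ∧' ψ)  = toNu φ ∧' toNu ψ
toNu (μ' φ)    = ν' (replaceUnguarded₀ ⊥F (toNu φ))
toNu (ν' φ)    = ν' (replaceUnguarded₀ ⊤F (toNu φ))

toNu-guarded : (φ : Fm k n) → PastFm φ → Guarded (const false) (toNu φ)
toNu-guarded (var v)   p        = refl
toNu-guarded (let' a)  p        = tt
toNu-guarded (nlet a)  p        = tt
toNu-guarded (at0 a)   p        = tt
toNu-guarded (nat0 a)  p        = tt
toNu-guarded (mod M φ) (pM , p) = pM , toNu-guarded φ p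
toNu-guarded (φ ∨' ψ)  (p , q)  = toNu-guarded φ p , toNu-guarded ψ q
toNu-guarded (φ ∧' ψ)  (p , q)  = toNu-guarded φ p , toNu-guarded ψ q
toNu-guarded (μ' φ)    p        = replaceUnguarded₀-guarded (toNu φ) (toNu-guarded φ p) (tt , tt)
toNu-guarded (ν' φ)    p        = replaceUnguarded₀-guarded (toNu φ) (toNu-guarded φ p) (tt , tt)

_⊆ᵛ_ : Val n → Val n → Set
ρ ⊆ᵛ ρ′ = ∀ v → ρ v ⊆ ρ′ v

▹-mono : {ρ ρ′ : Val n} {X Y : Pred} → ρ ⊆ᵛ ρ′ → X ⊆ Y → (ρ ▹ X) ⊆ᵛ (ρ′ ▹ Y)
▹-mono ρ⊆ρ′ X⊆Y zero    = X⊆Y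
▹-mono ρ⊆ρ′ X⊆Y (suc v) = ρ⊆ρ′ v

_⊆[_∣_]_ : Val n → (Fin n → Bool) → ℕ → Val n → Set
ρ ⊆[ g ∣ i ] ρ′ = ∀ v {j} → j ≤ i → (g v ≡ true → j < i) → ρ v j → ρ′ v j

⊆[]-below : {ρ ρ′ : Val n} {g g′ : Fin n → Bool} {i j : ℕ} →
            j < i → ρ ⊆[ g ∣ i ] ρ′ → ρ ⊆[ g′ ∣ j ] ρ′
⊆[]-below j<i ρ⊆ρ′ v l≤j _ = ρ⊆ρ′ v (≤-trans l≤j (<⇒≤ j<i)) (λ _ → ≤-<-trans l≤j j<i)

∪-≐ : {P P′ Q Q′ : Pred} → P ≐ P′ → Q ≐ Q′ → P ∪ Q ≐ P′ ∪ Q′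
∪-≐ (f , f′) (g , g′) = Sum.map f g , Sum.map f′ g′

∩-≐ : {P P′ Q Q′ : Pred} → P ≐ P′ → Q ≐ Q′ → P ∩ Q ≐ P′ ∩ Q′
∩-≐ (f , f′) (g , g′) = Product.map f g , Product.map f′ g′

⋃-≐ : {I : Set} {P Q : I → Pred} → (∀ a → P a ≐ Q a) → ⋃ I P ≐ ⋃ I Q
⋃-≐ P≐Q = (λ (a , x) → a , proj₁ (P≐Q a) x) , (λ (a , y) → a , proj₂ (P≐Q a) y)

⋂-≐ : {I : Set} {P Q : I → Pred} → (∀ a → P a ≐ Q a) → ⋂ I P ≐ ⋂ I Q
⋂-≐ P≐Q = (λ x a → proj₁ (P≐Q a) (x a)) , (λ y a → proj₂ (P≐Q a) (y a))

⊎-pair : {A B Q : Set} → A ⊎ Q → B ⊎ Q → (A × B) ⊎ Q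
⊎-pair (inj₁ a) (inj₁ b) = inj₁ (a , b)
⊎-pair (inj₁ _) (inj₂ q) = inj₂ q
⊎-pair (inj₂ q) _        = inj₂ q

finOrd : ℕ → Ord
finOrd zero    = oz
finOrd (suc m) = os (finOrd m)

module _ {k : ℕ} {D : Set} (w : Word k D) where
  open Sem w

  modal-mono : ∀ M {P Q : Pred} → P ⊆ Q → modal M P ⊆ modal M Q
  modal-mono Xg P⊆Q (d , x)     = d , P⊆Q x
  modal-mono Xc P⊆Q (j , c , x) = j , c , P⊆Q x
  modal-mono Yg P⊆Q (j , e , x) = j , e , P⊆Q x
  modal-mono Yc P⊆Q (j , c , x) = j , c , P⊆Q x

  modal-≐ : ∀ M {P Q : Pred} → P ≐ Q → modal M P ≐ modal M Q
  modal-≐ M (P⊆Q , Q⊆P) = modal-mono M P⊆Q , modal-mono M Q⊆P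

  μ-⊆ : {φ : Fm k (suc n)} {ψ : Fm k (suc m)} {ρ : Val n} {ρ′ : Val m} →
        (∀ {X Y} → X ⊆ Y → ⟦ φ ⟧ (ρ ▹ X) ⊆ ⟦ ψ ⟧ (ρ′ ▹ Y)) → ⟦ μ' φ ⟧ ρ ⊆ ⟦ μ' ψ ⟧ ρ′
  μ-⊆ {φ = φ} {ψ} {ρ} {ρ′} step (α , x) = α , approx α x
    where
    approx : ∀ α → muApp φ ρ α ⊆ muApp ψ ρ′ α
    approx oz       ()
    approx (os α)   x       = step (approx α) x
    approx (olim f) (m , x) = m , approx (f m) x

  ν-⊆ : {φ : Fm k (suc n)} {ψ : Fm k (suc m)} {ρ : Val n} {ρ′ : Val m} →
        (∀ {X Y} → X ⊆ Y → ⟦ φ ⟧ (ρ ▹ X) ⊆ ⟦ ψ ⟧ (ρ′ ▹ Y)) → ⟦ ν' φ ⟧ ρ ⊆ ⟦ ν' ψ ⟧ ρ′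
  ν-⊆ {φ = φ} {ψ} {ρ} {ρ′} step x α = approx α (x α)
    where
    approx : ∀ α → nuApp φ ρ α ⊆ nuApp ψ ρ′ α
    approx oz       _ = tt
    approx (os α)   x = step (approx α) x
    approx (olim f) x = λ m → approx (f m) (x m)

  μ-≐ : {φ : Fm k (suc n)} {ψ : Fm k (suc m)} {ρ : Val n} {ρ′ : Val m} →
        (∀ {X Y} → X ≐ Y → ⟦ φ ⟧ (ρ ▹ X) ≐ ⟦ ψ ⟧ (ρ′ ▹ Y)) → ⟦ μ' φ ⟧ ρ ≐ ⟦ μ' ψ ⟧ ρ′
  μ-≐ {φ = φ} {ψ} {ρ} {ρ′} step = ⋃-≐ approx
    where
    approx : ∀ α → muApp φ ρ α ≐ muApp ψ ρ′ α
    approx oz       = (λ ()) , (λ ())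
    approx (os α)   = step (approx α)
    approx (olim f) = ⋃-≐ (approx ∘ f)

  ν-≐ : {φ : Fm k (suc n)} {ψ : Fm k (suc m)} {ρ : Val n} {ρ′ : Val m} →
        (∀ {X Y} → X ≐ Y → ⟦ φ ⟧ (ρ ▹ X) ≐ ⟦ ψ ⟧ (ρ′ ▹ Y)) → ⟦ ν' φ ⟧ ρ ≐ ⟦ ν' ψ ⟧ ρ′
  ν-≐ {φ = φ} {ψ} {ρ} {ρ′} step = ⋂-≐ approx
    where
    approx : ∀ α → nuApp φ ρ α ≐ nuApp ψ ρ′ α
    approx oz       = (λ _ → tt) , (λ _ → tt)
    approx (os α)   = step (approx α)
    approx (olim f) = ⋂-≐ (approx ∘ f)

  ⟦⟧-mono : (φ : Fm k n) {ρ ρ′ : Val n} → ρ ⊆ᵛ ρ′ → ⟦ φ ⟧ ρ ⊆ ⟦ φ ⟧ ρ′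
  ⟦⟧-mono (var v)   ρ⊆ρ′ x = ρ⊆ρ′ v x
  ⟦⟧-mono (let' a)  ρ⊆ρ′ x = x
  ⟦⟧-mono (nlet a)  ρ⊆ρ′ x = x
  ⟦⟧-mono (at0 a)   ρ⊆ρ′ x = x
  ⟦⟧-mono (nat0 a)  ρ⊆ρ′ x = x
  ⟦⟧-mono (mod M φ) ρ⊆ρ′ x = modal-mono M (⟦⟧-mono φ ρ⊆ρ′) x
  ⟦⟧-mono (φ ∨' ψ)  ρ⊆ρ′ x = Sum.map (⟦⟧-mono φ ρ⊆ρ′) (⟦⟧-mono ψ ρ⊆ρ′) x
  ⟦⟧-mono (φ ∧' ψ)  ρ⊆ρ′ x = Product.map (⟦⟧-mono φ ρ⊆ρ′) (⟦⟧-mono ψ ρ⊆ρ′) x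
  ⟦⟧-mono (μ' φ)    ρ⊆ρ′ x = μ-⊆ (λ X⊆Y → ⟦⟧-mono φ (▹-mono ρ⊆ρ′ X⊆Y)) x
  ⟦⟧-mono (ν' φ)    ρ⊆ρ′ x = ν-⊆ (λ X⊆Y → ⟦⟧-mono φ (▹-mono ρ⊆ρ′ X⊆Y)) x

  ⟦⟧-mono₀ : (φ : Fm k (suc n)) {ρ : Val n} {X Y : Pred} → X ⊆ Y → ⟦ φ ⟧ (ρ ▹ X) ⊆ ⟦ φ ⟧ (ρ ▹ Y)
  ⟦⟧-mono₀ φ X⊆Y = ⟦⟧-mono φ (▹-mono (λ _ → id) X⊆Y)

  ren-sem : (φ : Fm k n) {r : Fin n → Fin m} {ρ : Val m} {ρ′ : Val n} →
            (∀ v → ρ (r v) ≐ ρ′ v) → ⟦ ren r φ ⟧ ρ ≐ ⟦ φ ⟧ ρ′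
  ren-sem (var v)   ρ≐ρ′ = ρ≐ρ′ v
  ren-sem (let' a)  ρ≐ρ′ = ≐-refl
  ren-sem (nlet a)  ρ≐ρ′ = ≐-refl
  ren-sem (at0 a)   ρ≐ρ′ = ≐-refl
  ren-sem (nat0 a)  ρ≐ρ′ = ≐-refl
  ren-sem (mod M φ) ρ≐ρ′ = modal-≐ M (ren-sem φ ρ≐ρ′)
  ren-sem (φ ∨' ψ)  ρ≐ρ′ = ∪-≐ (ren-sem φ ρ≐ρ′) (ren-sem ψ ρ≐ρ′)
  ren-sem (φ ∧' ψ)  ρ≐ρ′ = ∩-≐ (ren-sem φ ρ≐ρ′) (ren-sem ψ ρ≐ρ′)
  ren-sem (μ' φ)    ρ≐ρ′ = μ-≐ (λ X≐Y → ren-sem φ λ { zero → X≐Y ; (suc v) → ρ≐ρ′ v })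
  ren-sem (ν' φ)    ρ≐ρ′ = ν-≐ (λ X≐Y → ren-sem φ λ { zero → X≐Y ; (suc v) → ρ≐ρ′ v })

  liftSub-sem : {σ : Fin n → Fm k m} {ρ : Val m} {ρ′ : Val n} {X Y : Pred} →
                (∀ v → ⟦ σ v ⟧ ρ ≐ ρ′ v) → X ≐ Y → ∀ v → ⟦ liftSub σ v ⟧ (ρ ▹ X) ≐ (ρ′ ▹ Y) v
  liftSub-sem σ≐ρ′ X≐Y zero        = X≐Y
  liftSub-sem {σ = σ} σ≐ρ′ X≐Y (suc v) = ≐-trans (ren-sem (σ v) (λ _ → ≐-refl)) (σ≐ρ′ v)

  sub-sem : (φ : Fm k n) {σ : Fin n → Fm k m} {ρ : Val m} {ρ′ : Val n} →
            (∀ v → ⟦ σ v ⟧ ρ ≐ ρ′ v) → ⟦ sub φ σ ⟧ ρ ≐ ⟦ φ ⟧ ρ′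
  sub-sem (var v)   σ≐ρ′ = σ≐ρ′ v
  sub-sem (let' a)  σ≐ρ′ = ≐-refl
  sub-sem (nlet a)  σ≐ρ′ = ≐-refl
  sub-sem (at0 a)   σ≐ρ′ = ≐-refl
  sub-sem (nat0 a)  σ≐ρ′ = ≐-refl
  sub-sem (mod M φ) σ≐ρ′ = modal-≐ M (sub-sem φ σ≐ρ′)
  sub-sem (φ ∨' ψ)  σ≐ρ′ = ∪-≐ (sub-sem φ σ≐ρ′) (sub-sem ψ σ≐ρ′)
  sub-sem (φ ∧' ψ)  σ≐ρ′ = ∩-≐ (sub-sem φ σ≐ρ′) (sub-sem ψ σ≐ρ′)
  sub-sem (μ' φ)    σ≐ρ′ = μ-≐ (λ X≐Y → sub-sem φ (liftSub-sem σ≐ρ′ X≐Y))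
  sub-sem (ν' φ)    σ≐ρ′ = ν-≐ (λ X≐Y → sub-sem φ (liftSub-sem σ≐ρ′ X≐Y))

  ν-fold : (φ : Fm k (suc n)) {ρ : Val n} → ⟦ φ ⟧ (ρ ▹ ⟦ ν' φ ⟧ ρ) ⊆ ⟦ ν' φ ⟧ ρ
  ν-fold φ x oz       = tt
  ν-fold φ x (os α)   = ⟦⟧-mono₀ φ (λ y → y α) x
  ν-fold φ x (olim f) = λ m → ν-fold φ x (f m)

  ν-greatest : (φ : Fm k (suc n)) {ρ : Val n} {X : Pred} → X ⊆ ⟦ φ ⟧ (ρ ▹ X) → X ⊆ ⟦ ν' φ ⟧ ρ
  ν-greatest φ {ρ} {X} X⊆φX x α = approx α x
    where
    approx : ∀ α → X ⊆ nuApp φ ρ α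
    approx oz       _   = tt
    approx (os α)   x   = ⟦⟧-mono₀ φ (approx α) (X⊆φX x)
    approx (olim f) x m = approx (f m) x

  μApp-least : (φ : Fm k (suc n)) {ρ : Val n} {X : Pred} → ⟦ φ ⟧ (ρ ▹ X) ⊆ X →
               ∀ α → muApp φ ρ α ⊆ X
  μApp-least φ φX⊆X oz       ()
  μApp-least φ φX⊆X (os α)   x       = φX⊆X (⟦⟧-mono₀ φ (μApp-least φ φX⊆X α) x)
  μApp-least φ φX⊆X (olim f) (m , x) = μApp-least φ φX⊆X (f m) x

  μ-least : (φ : Fm k (suc n)) {ρ : Val n} {X : Pred} → ⟦ φ ⟧ (ρ ▹ X) ⊆ X → ⟦ μ' φ ⟧ ρ ⊆ X
  μ-least φ φX⊆X (α , x) = μApp-least φ φX⊆X α x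

  guarded-local : (φ : Fm k n) {g : Fin n → Bool} {i : ℕ} {ρ ρ′ : Val n} →
                  Guarded g φ → ρ ⊆[ g ∣ i ] ρ′ → ⟦ φ ⟧ ρ i → ⟦ φ ⟧ ρ′ i
  guarded-local (var v)    p        ρ⊆ρ′ x =
    ρ⊆ρ′ v ≤-refl (λ e → contradiction (trans (sym p) e) λ ()) x
  guarded-local (let' a)   p        ρ⊆ρ′ x = x
  guarded-local (nlet a)   p        ρ⊆ρ′ x = x
  guarded-local (at0 a)    p        ρ⊆ρ′ x = x
  guarded-local (nat0 a)   p        ρ⊆ρ′ x = x
  guarded-local (mod Yg φ) (_ , p)  ρ⊆ρ′ (j , refl , x) =
    j , refl , guarded-local φ p (⊆[]-below (n<1+n j) ρ⊆ρ′) x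
  guarded-local (mod Yc φ) (_ , p)  ρ⊆ρ′ (j , c , x) =
    j , c , guarded-local φ p (⊆[]-below (proj₁ c) ρ⊆ρ′) x
  guarded-local (φ ∨' ψ)   (p , q)  ρ⊆ρ′ x =
    Sum.map (guarded-local φ p ρ⊆ρ′) (guarded-local ψ q ρ⊆ρ′) x
  guarded-local (φ ∧' ψ)   (p , q)  ρ⊆ρ′ x =
    Product.map (guarded-local φ p ρ⊆ρ′) (guarded-local ψ q ρ⊆ρ′) x
  guarded-local (ν' θ) {i = i} {ρ} {ρ′} p ρ⊆ρ′ x α = approx α ≤-refl (x α)
    where
    approx : ∀ α {j} → j ≤ i → nuApp θ ρ α j → nuApp θ ρ′ α j
    approx oz       _   _ = tt
    approx (os α)   j≤i y = guarded-local θ p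
      (λ { zero    l≤j _   → approx α (≤-trans l≤j j≤i)
         ; (suc v) l≤j l<j → ρ⊆ρ′ v (≤-trans l≤j j≤i) (λ e → <-≤-trans (l<j e) j≤i) })
      y
    approx (olim f) j≤i y = λ m → approx (f m) j≤i (y m)

  -- Each unfolding of a guarded body reads the variable only strictly before the current position.
  guarded-νApp⊆μApp : (θ : Fm k (suc n)) {g : Fin n → Bool} {ρ : Val n} → Guarded (true ∷ g) θ →
                      ∀ m {j} → j < m → nuApp θ ρ (finOrd m) j → muApp θ ρ (finOrd m) j
  guarded-νApp⊆μApp θ p (suc m) j<1+m x = guarded-local θ p
    (λ { zero    _ l<j y → guarded-νApp⊆μApp θ p m (<-≤-trans (l<j refl) (≤-pred j<1+m)) y
       ; (suc v) _ _   y → y })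
    x

  guarded-ν⊆μ : (θ : Fm k (suc n)) {g : Fin n → Bool} {ρ : Val n} → Guarded (true ∷ g) θ →
                ⟦ ν' θ ⟧ ρ ⊆ ⟦ μ' θ ⟧ ρ
  guarded-ν⊆μ θ p {i} x =
    finOrd (suc i) , guarded-νApp⊆μApp θ p (suc i) (n<1+n i) (x (finOrd (suc i)))

  guarded-ν-unfold : (θ : Fm k (suc n)) {g : Fin n → Bool} {ρ : Val n} → Guarded (true ∷ g) θ →
                     ⟦ ν' θ ⟧ ρ ⊆ ⟦ θ ⟧ (ρ ▹ ⟦ ν' θ ⟧ ρ)
  guarded-ν-unfold θ p {i} x =
    ⟦⟧-mono₀ θ (μApp-least θ (ν-fold θ) (finOrd (suc i)))
      (guarded-νApp⊆μApp θ p (suc (suc i)) (m<n⇒m<1+n (n<1+n i)) (x (finOrd (suc (suc i)))))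

  splitSub-⊆ : (ψ : Fm k n) {g : Fin n → Bool} {σ τ : Fin n → Fm k m} {ρ : Val m} {ρ′ : Val n}
               {i : ℕ} → Guarded g ψ → (∀ v → ⟦ τ v ⟧ ρ ≐ ρ′ v) →
               (∀ v → g v ≡ false → ⟦ σ v ⟧ ρ i → ρ′ v i) →
               ⟦ splitSub ψ σ τ ⟧ ρ i → ⟦ ψ ⟧ ρ′ i
  splitSub-⊆ (var v)   p       τ≐ρ′ σ⊆ρ′ x = σ⊆ρ′ v p x
  splitSub-⊆ (let' a)  p       τ≐ρ′ σ⊆ρ′ x = x
  splitSub-⊆ (nlet a)  p       τ≐ρ′ σ⊆ρ′ x = x
  splitSub-⊆ (at0 a)   p       τ≐ρ′ σ⊆ρ′ x = x
  splitSub-⊆ (nat0 a)  p       τ≐ρ′ σ⊆ρ′ x = x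
  splitSub-⊆ (mod M φ) p       τ≐ρ′ σ⊆ρ′ x = modal-mono M (proj₁ (sub-sem φ τ≐ρ′)) x
  splitSub-⊆ (φ ∨' ψ)  (p , q) τ≐ρ′ σ⊆ρ′ x =
    Sum.map (splitSub-⊆ φ p τ≐ρ′ σ⊆ρ′) (splitSub-⊆ ψ q τ≐ρ′ σ⊆ρ′) x
  splitSub-⊆ (φ ∧' ψ)  (p , q) τ≐ρ′ σ⊆ρ′ x =
    Product.map (splitSub-⊆ φ p τ≐ρ′ σ⊆ρ′) (splitSub-⊆ ψ q τ≐ρ′ σ⊆ρ′) x
  splitSub-⊆ (ν' θ)    p       τ≐ρ′ σ⊆ρ′ x = ν-fold θ (splitSub-⊆ θ p
    (λ { zero → sub-sem (ν' θ) τ≐ρ′ ; (suc v) → τ≐ρ′ v })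
    (λ { zero () ; (suc v) → σ⊆ρ′ v })
    x)

  splitSub-⊇ : (ψ : Fm k n) {g : Fin n → Bool} {σ τ : Fin n → Fm k m} {ρ : Val m} {ρ′ : Val n}
               {i : ℕ} {Q : Set} → Guarded g ψ → (∀ v → ⟦ τ v ⟧ ρ ≐ ρ′ v) →
               (∀ v → g v ≡ false → ρ′ v i → ⟦ σ v ⟧ ρ i ⊎ Q) →
               ⟦ ψ ⟧ ρ′ i → ⟦ splitSub ψ σ τ ⟧ ρ i ⊎ Q
  splitSub-⊇ (var v)   p       τ≐ρ′ ρ′⊆σ x = ρ′⊆σ v p x
  splitSub-⊇ (let' a)  p       τ≐ρ′ ρ′⊆σ x = inj₁ x
  splitSub-⊇ (nlet a)  p       τ≐ρ′ ρ′⊆σ x = inj₁ x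
  splitSub-⊇ (at0 a)   p       τ≐ρ′ ρ′⊆σ x = inj₁ x
  splitSub-⊇ (nat0 a)  p       τ≐ρ′ ρ′⊆σ x = inj₁ x
  splitSub-⊇ (mod M φ) p       τ≐ρ′ ρ′⊆σ x = inj₁ (modal-mono M (proj₂ (sub-sem φ τ≐ρ′)) x)
  splitSub-⊇ (φ ∨' ψ)  (p , q) τ≐ρ′ ρ′⊆σ (inj₁ x) = Sum.map₁ inj₁ (splitSub-⊇ φ p τ≐ρ′ ρ′⊆σ x)
  splitSub-⊇ (φ ∨' ψ)  (p , q) τ≐ρ′ ρ′⊆σ (inj₂ y) = Sum.map₁ inj₂ (splitSub-⊇ ψ q τ≐ρ′ ρ′⊆σ y)
  splitSub-⊇ (φ ∧' ψ)  (p , q) τ≐ρ′ ρ′⊆σ (x , y) =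
    ⊎-pair (splitSub-⊇ φ p τ≐ρ′ ρ′⊆σ x) (splitSub-⊇ ψ q τ≐ρ′ ρ′⊆σ y)
  splitSub-⊇ (ν' θ)    p       τ≐ρ′ ρ′⊆σ x = splitSub-⊇ θ p
    (λ { zero → sub-sem (ν' θ) τ≐ρ′ ; (suc v) → τ≐ρ′ v })
    (λ { zero () ; (suc v) → ρ′⊆σ v })
    (guarded-ν-unfold θ p x)

  replaceUnguarded₀-⊆ : (ψ : Fm k (suc n)) {χ : Fm k (suc n)} {ρ : Val n} {X : Pred} {i : ℕ} →
                        Guarded (const false) ψ → (⟦ χ ⟧ (ρ ▹ X) i → X i) →
                        ⟦ replaceUnguarded₀ χ ψ ⟧ (ρ ▹ X) i → ⟦ ψ ⟧ (ρ ▹ X) i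
  replaceUnguarded₀-⊆ ψ p χ⊆X =
    splitSub-⊆ ψ p (λ _ → ≐-refl) (λ { zero _ → χ⊆X ; (suc v) _ → id })

  replaceUnguarded₀-⊇ : (ψ : Fm k (suc n)) {χ : Fm k (suc n)} {ρ : Val n} {X : Pred} {i : ℕ}
                        {Q : Set} → Guarded (const false) ψ → (X i → ⟦ χ ⟧ (ρ ▹ X) i ⊎ Q) →
                        ⟦ ψ ⟧ (ρ ▹ X) i → ⟦ replaceUnguarded₀ χ ψ ⟧ (ρ ▹ X) i ⊎ Q
  replaceUnguarded₀-⊇ ψ p X⊆χ =
    splitSub-⊇ ψ p (λ _ → ≐-refl) (λ { zero _ → X⊆χ ; (suc v) _ → inj₁ })

  μ-replace : (ψ : Fm k (suc n)) {ρ : Val n} → Guarded (const false) ψ →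
              ⟦ μ' ψ ⟧ ρ ≐ ⟦ ν' (replaceUnguarded₀ ⊥F ψ) ⟧ ρ
  μ-replace ψ p =
    μ-least ψ (λ x → [ ν-fold B , id ] (replaceUnguarded₀-⊇ ψ p inj₂ x)) ,
    λ x → μ-⊆ {φ = B} {ψ = ψ} B⊆ψ (guarded-ν⊆μ B (replaceUnguarded₀-guarded ψ p (tt , tt)) x)
    where
    B = replaceUnguarded₀ ⊥F ψ
    B⊆ψ : ∀ {ρ X Y} → X ⊆ Y → ⟦ B ⟧ (ρ ▹ X) ⊆ ⟦ ψ ⟧ (ρ ▹ Y)
    B⊆ψ X⊆Y y = ⟦⟧-mono₀ ψ X⊆Y (replaceUnguarded₀-⊆ ψ p (λ (z , ¬z) → contradiction z ¬z) y)

  ν-replace : (ψ : Fm k (suc n)) {ρ : Val n} → Guarded (const false) ψ →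
              ⟦ ν' ψ ⟧ ρ ≐ ⟦ ν' (replaceUnguarded₀ ⊤F ψ) ⟧ ρ
  ν-replace ψ p =
    ν-⊆ {φ = ψ} {ψ = B} ψ⊆B ,
    ν-greatest ψ (λ x → replaceUnguarded₀-⊆ ψ p (λ _ → x)
                          (guarded-ν-unfold B (replaceUnguarded₀-guarded ψ p (tt , tt)) x))
    where
    B = replaceUnguarded₀ ⊤F ψ
    ψ⊆B : ∀ {ρ X Y} → X ⊆ Y → ⟦ ψ ⟧ (ρ ▹ X) ⊆ ⟦ B ⟧ (ρ ▹ Y)
    ψ⊆B X⊆Y {i} x =
      [ id , ⊥-elim ] (replaceUnguarded₀-⊇ ψ p (λ _ → inj₁ (toSum (i ≟ 0))) (⟦⟧-mono₀ ψ X⊆Y x))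

  toNu-sound : (φ : Fm k n) {ρ ρ′ : Val n} → PastFm φ → (∀ v → ρ v ≐ ρ′ v) →
               ⟦ φ ⟧ ρ ≐ ⟦ toNu φ ⟧ ρ′
  toNu-sound (var v)   p       ρ≐ρ′ = ρ≐ρ′ v
  toNu-sound (let' a)  p       ρ≐ρ′ = ≐-refl
  toNu-sound (nlet a)  p       ρ≐ρ′ = ≐-refl
  toNu-sound (at0 a)   p       ρ≐ρ′ = ≐-refl
  toNu-sound (nat0 a)  p       ρ≐ρ′ = ≐-refl
  toNu-sound (mod M φ) (_ , p) ρ≐ρ′ = modal-≐ M (toNu-sound φ p ρ≐ρ′)
  toNu-sound (φ ∨' ψ)  (p , q) ρ≐ρ′ = ∪-≐ (toNu-sound φ p ρ≐ρ′) (toNu-sound ψ q ρ≐ρ′)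
  toNu-sound (φ ∧' ψ)  (p , q) ρ≐ρ′ = ∩-≐ (toNu-sound φ p ρ≐ρ′) (toNu-sound ψ q ρ≐ρ′)
  toNu-sound (μ' φ)    p       ρ≐ρ′ =
    ≐-trans (μ-≐ (λ X≐Y → toNu-sound φ p λ { zero → X≐Y ; (suc v) → ρ≐ρ′ v }))
            (μ-replace (toNu φ) (toNu-guarded φ p))
  toNu-sound (ν' φ)    p       ρ≐ρ′ =
    ≐-trans (ν-≐ (λ X≐Y → toNu-sound φ p λ { zero → X≐Y ; (suc v) → ρ≐ρ′ v }))
            (ν-replace (toNu φ) (toNu-guarded φ p))

_≈_ : Fm k n → Fm k n → Set₁
φ ≈ ψ = ∀ {D : Set} (w : Word _ D) ρ → Sem.⟦_⟧ w φ ρ ≐ Sem.⟦_⟧ w ψ ρ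

NuDefinable : Fm k n → Set₁
NuDefinable {k} {n} φ = Σ (Fm k n) λ ψ → NuFrag ψ × φ ≈ ψ

pastFm-nuDefinable : (φ : Fm k n) → PastFm φ → NuDefinable φ
pastFm-nuDefinable φ p =
  toNu φ , Guarded⇒NuFrag (toNu φ) (toNu-guarded φ p) , λ w ρ → toNu-sound w φ p (λ _ → ≐-refl)

pastOrNu-nuDefinable : (φ : Fm k n) → PastOrNu φ → NuDefinable φ
pastOrNu-nuDefinable φ (inj₁ p) = pastFm-nuDefinable φ p
pastOrNu-nuDefinable φ (inj₂ q) = φ , q , λ _ _ → ≐-refl

nuDefinable-sub : (ψ : Fm k n) {σ : Fin n → Fm k m} → NuDefinable ψ →
                  (∀ v → NuDefinable (σ v)) → NuDefinable (sub ψ σ)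
nuDefinable-sub ψ {σ} (ψ′ , ψ′-ν , ψ≈ψ′) σ-def =
  sub ψ′ (proj₁ ∘ σ-def) , NuFrag-sub ψ′ ψ′-ν (proj₁ ∘ proj₂ ∘ σ-def) , sub≈sub
  where
  sub≈sub : sub ψ σ ≈ sub ψ′ (proj₁ ∘ σ-def)
  sub≈sub w ρ =
    ≐-trans (sub-sem w ψ (λ _ → ≐-refl))
    (≐-trans (ψ≈ψ′ w _)
    (≐-sym (sub-sem w ψ′ (λ v → ≐-sym (proj₂ (proj₂ (σ-def v)) w ρ)))))

compN-nuDefinable : {Ψ : FmSet k} → (∀ {n} (ψ : Fm k n) → Ψ ψ → NuDefinable ψ) →
                    ∀ i (φ : Fm k 0) → CompN Ψ i φ → NuDefinable φ
compN-nuDefinable Ψ-def (suc i) _ (_ , ψ , σ , ψ∈Ψ , σ∈Comp , refl) =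
  nuDefinable-sub ψ (Ψ-def ψ ψ∈Ψ) (λ v → compN-nuDefinable Ψ-def i (σ v) (σ∈Comp v))

nuDefinable⇒Equiv : {D : Set} (C : Word k D → Set) (φ : Fm k n) → NuDefinable φ →
                    Σ (Fm k n) λ ψ → NuFrag ψ × Equiv {D = D} C φ ψ
nuDefinable⇒Equiv C φ (ψ , ψ-ν , φ≈ψ) =
  ψ , ψ-ν , λ w _ ρ _ _ → mk⇔ (proj₁ (φ≈ψ w ρ)) (proj₂ (φ≈ψ w ρ))

theorem7 : (k : ℕ) (D : Set) → Infinite D →
    ((n : ℕ) (φ : Fm k n) → PastFm φ →
       Σ (Fm k n) λ ψ → NuFrag ψ × Equiv {D = D} IsOmegaWord φ ψ)
    ×
    ((φ : Fm k 0) → Comp PastOrNu φ →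
       (Σ (Fm k 0) λ ψ → NuFrag ψ × Equiv {D = D} IsFiniteWord φ ψ)
       × (Σ (Fm k 0) λ ψ → NuFrag ψ × Equiv {D = D} IsOmegaWord φ ψ))
theorem7 k D _ =
  (λ n φ p → nuDefinable⇒Equiv IsOmegaWord φ (pastFm-nuDefinable φ p)) ,
  λ φ (i , c) → let φ-def = compN-nuDefinable pastOrNu-nuDefinable i φ c in
    nuDefinable⇒Equiv IsFiniteWord φ φ-def , nuDefinable⇒Equiv IsOmegaWord φ φ-def
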